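{- Let $m,n$ be positive integers and let $K_{m,n}$ be the complete bipartite graph with parts of sizes $m$ and $n$. Then \[\beta(F_2(K_{m,n}))=\max\Big\{mn,\ \binom{m+n}{2}-mn\Big\}.\]
   Context: For a simple finite graph $G$, the $2$-token graph $F_2(G)$ is the graph whose vertices are all $2$-element subsets of $V(G)$, two such subsets being adjacent iff their symmetric difference is an edge of $G$. $\beta(H)$ denotes the independence number of a graph $H$ (the maximum size of a set of pairwise non-adjacent vertices). -}

module Defs where

open import Data.Nat using (ℕ; _<_; _≤_; _+_)
open import Data.Fin using (Fin; toℕ)
open import Data.Fin.Subset using (Subset; ⁅_⁆; _∪_; _─_; ∣_∣)
open import Data.List using (List; length)
open import Data.List.Relation.Unary.All using (All)
open import Data.List.Relation.Unary.Unique.Propositional using (Unique)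
open import Data.List.Relation.Unary.AllPairs using (AllPairs)
open import Data.Product using (Σ; ∃₂; _×_)
open import Data.Sum using (_⊎_)
open import Relation.Nullary using (¬_)
open import Relation.Binary.PropositionalEquality using (_≡_; _≢_)

record Graph (N : ℕ) : Set₁ where
  field
    Adj : Fin N → Fin N → Set
open Graph public

K : (m n : ℕ) → Graph (m + n)
K m n = record { Adj = λ i j → (toℕ i < m × m ≤ toℕ j) ⊎ (m ≤ toℕ i × toℕ j < m) }

module _ {N : ℕ} (G : Graph N) where

  IsEdge : Subset N → Set
  IsEdge e = ∃₂ λ x y → x ≢ y × Adj G x y × e ≡ ⁅ x ⁆ ∪ ⁅ y ⁆

  _Δ_ : Subset N → Subset N → Subset N
  A Δ B = (A ─ B) ∪ (B ─ A)

  IsToken : Subset N → Set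
  IsToken A = ∣ A ∣ ≡ 2

  TokenAdj : Subset N → Subset N → Set
  TokenAdj A B = IsEdge (A Δ B)

  IsIndependentF₂ : List (Subset N) → Set
  IsIndependentF₂ S = All IsToken S × Unique S × AllPairs (λ A B → ¬ TokenAdj A B) S

  IndepNumberF₂ : ℕ → Set
  IndepNumberF₂ k =
    (Σ (List (Subset N)) λ S → IsIndependentF₂ S × length S ≡ k)
    × (∀ S → IsIndependentF₂ S → length S ≤ k)

-- Two tokens {p, x} and {p, y} of F₂(K_{m,n}) are adjacent exactly when x and y lie in
-- different parts. Given an independent set S, mark every vertex that lies in a cross token of
-- S, i.e. one meeting both parts. A marked vertex x lies in no token {x, y} of S inside one
-- part: with a cross token {x, z} of S it would form an adjacent pair. So every token of S is
-- an unmarked pair inside one part or a marked pair across the parts. If a and b vertices of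
-- the two parts are unmarked and c and d are marked, then
--   |S| ≤ C(a,2) + C(b,2) + c·d,
-- which is at most mn when a = b = 0 and at most C(m,2) + C(n,2) otherwise. All pairs across
-- the parts, respectively all pairs inside a part, attain these values.

module Submission where

open import Defs
open import Data.Nat using (ℕ; zero; suc; _+_; _*_; _∸_; _⊔_; _≤_; _<_; z≤n; s≤s; NonZero)
import Data.Nat.Properties as ℕ
open import Data.Nat.Combinatorics using (_C_; nCk+nC[k+1]≡[n+1]C[k+1]; nC1≡n)
open import Data.Nat.Tactic.RingSolver using (solve-∀)
open import Data.Bool using (Bool; true; false; not; _∧_; _xor_)
import Data.Bool.Properties as Bool
open import Data.Fin using (Fin; zero; suc; toℕ; _≟_)
import Data.Fin.Properties as Fin
open import Data.Fin.Subset using (Subset; _∈_; _∉_; ∣_∣; inside; outside; ⁅_⁆; _∪_; _─_; _-_)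
  renaming (⊥ to ∅)
open import Data.Fin.Subset.Properties
  using ( _∈?_; x∈p∪q⁻; x∈p∪q⁺; x∈p∧x∉q⇒x∈p─q; x∈p∧x≢y⇒x∈p-y; x∈p⇒∣p-x∣<∣p∣
        ; x∈⁅x⁆; x∈⁅y⁆⇒x≡y; ∣⁅x⁆∣≡1; ⊆-antisym)
open import Data.Vec using ([]; _∷_; here; there)
import Data.Vec.Properties as Vec
open import Data.List using (List; []; _∷_; _++_; map; length)
open import Data.List.Properties using (length-++; length-map)
open import Data.List.Membership.Propositional using (lose; find) renaming (_∈_ to _∈ₗ_)
open import Data.List.Membership.Propositional.Properties using (∈-++⁺ˡ; ∈-++⁺ʳ; ∈-map⁺; ∈-map⁻)
open import Data.List.Relation.Unary.All using (All; []; _∷_)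
import Data.List.Relation.Unary.All as All
import Data.List.Relation.Unary.All.Properties as All
open import Data.List.Relation.Unary.Any using (Any; here; there; any?)
open import Data.List.Relation.Unary.AllPairs using (AllPairs; []; _∷_)
open import Data.List.Relation.Unary.Unique.Propositional using (Unique)
import Data.List.Relation.Unary.Unique.Propositional.Properties as Unique
open import Data.List.Relation.Binary.Disjoint.Propositional using (Disjoint)
open import Data.Product using (∃; ∃₂; _×_; _,_; proj₁; proj₂)
open import Data.Sum using (_⊎_; inj₁; inj₂; [_,_]′)
import Data.Sum as Sum
open import Data.Empty using (⊥; ⊥-elim)
open import Function using (_∘_; _on_; const)
open import Relation.Nullary using (¬_; yes; no; Dec; does)
open import Relation.Nullary.Decidable using (_×-dec_; ¬?)
open import Relation.Binary.PropositionalEquality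

∈⇒remove : ∀ {A : Set} {x : A} {ys} → x ∈ₗ ys →
           ∃ λ zs → length ys ≡ suc (length zs) × (∀ {z} → z ∈ₗ ys → z ≢ x → z ∈ₗ zs)
∈⇒remove {ys = y ∷ ys} (here refl) = ys , refl , λ where
  (here refl)  z≢x → ⊥-elim (z≢x refl)
  (there z∈ys) _   → z∈ys
∈⇒remove {ys = y ∷ ys} (there x∈ys) with ∈⇒remove x∈ys
... | zs , eq , ys⊆zs = y ∷ zs , cong suc eq , λ where
  (here refl)  _   → here refl
  (there z∈ys) z≢x → there (ys⊆zs z∈ys z≢x)

unique-⊆⇒length≤ : ∀ {A : Set} {xs ys : List A} → Unique xs → (∀ {z} → z ∈ₗ xs → z ∈ₗ ys) →
                   length xs ≤ length ys
unique-⊆⇒length≤ {xs = []} _ _ = z≤n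
unique-⊆⇒length≤ {xs = x ∷ xs} (x∉xs ∷ xs!) xs⊆ys with ∈⇒remove (xs⊆ys (here refl))
... | zs , eq , ys⊆zs = subst (suc (length xs) ≤_) (sym eq) (s≤s (unique-⊆⇒length≤ xs! xs⊆zs))
  where
  xs⊆zs : ∀ {z} → z ∈ₗ xs → z ∈ₗ zs
  xs⊆zs z∈xs = ys⊆zs (xs⊆ys (there z∈xs)) λ { refl → All.lookup x∉xs z∈xs refl }

All⇒AllPairs : ∀ {A : Set} {P : A → Set} {R : A → A → Set} {xs} →
               (∀ {x y} → P x → P y → R x y) → All P xs → AllPairs R xs
All⇒AllPairs R-intro [] = []
All⇒AllPairs R-intro (px ∷ pxs) = All.map (R-intro px) pxs ∷ All⇒AllPairs R-intro pxs

AllPairs-lookup : ∀ {A : Set} {R : A → A → Set} {xs a b} → AllPairs R xs → a ∈ₗ xs → b ∈ₗ xs →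
                  a ≡ b ⊎ R a b ⊎ R b a
AllPairs-lookup (r ∷ rs) (here refl) (here refl) = inj₁ refl
AllPairs-lookup (r ∷ rs) (here refl) (there b∈xs) = inj₂ (inj₁ (All.lookup r b∈xs))
AllPairs-lookup (r ∷ rs) (there a∈xs) (here refl) = inj₂ (inj₂ (All.lookup r a∈xs))
AllPairs-lookup (r ∷ rs) (there a∈xs) (there b∈xs) = AllPairs-lookup rs a∈xs b∈xs

x∈p─q⁻ : ∀ {N} {x : Fin N} (p q : Subset N) → x ∈ p ─ q → x ∈ p × x ∉ q
x∈p─q⁻ (inside ∷ p) (outside ∷ q) here = here , λ ()
x∈p─q⁻ {x = zero} (outside ∷ p) (outside ∷ q) ()
x∈p─q⁻ {x = zero} (outside ∷ p) (inside ∷ q) ()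
x∈p─q⁻ (s ∷ p) (t ∷ q) (there x∈p─q) with x∈p─q⁻ p q x∈p─q
... | x∈p , x∉q = there x∈p , λ { (there x∈q) → x∉q x∈q }

x∈p─q∪q─p⁻ : ∀ {N} {x : Fin N} (p q : Subset N) → x ∈ (p ─ q) ∪ (q ─ p) →
              (x ∈ p × x ∉ q) ⊎ (x ∈ q × x ∉ p)
x∈p─q∪q─p⁻ p q x∈ = Sum.map (x∈p─q⁻ p q) (x∈p─q⁻ q p) (x∈p∪q⁻ (p ─ q) (q ─ p) x∈)

x∈⁅y⁆∪⁅z⁆⁻ : ∀ {N} {x y z : Fin N} → x ∈ ⁅ y ⁆ ∪ ⁅ z ⁆ → x ≡ y ⊎ x ≡ z
x∈⁅y⁆∪⁅z⁆⁻ {y = y} {z} x∈ with x∈p∪q⁻ ⁅ y ⁆ ⁅ z ⁆ x∈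
... | inj₁ x∈⁅y⁆ = inj₁ (x∈⁅y⁆⇒x≡y y x∈⁅y⁆)
... | inj₂ x∈⁅z⁆ = inj₂ (x∈⁅y⁆⇒x≡y z x∈⁅z⁆)

y∈⁅y⁆∪⁅z⁆ : ∀ {N} (y z : Fin N) → y ∈ ⁅ y ⁆ ∪ ⁅ z ⁆
y∈⁅y⁆∪⁅z⁆ y z = x∈p∪q⁺ (inj₁ (x∈⁅x⁆ y))

z∈⁅y⁆∪⁅z⁆ : ∀ {N} (y z : Fin N) → z ∈ ⁅ y ⁆ ∪ ⁅ z ⁆
z∈⁅y⁆∪⁅z⁆ y z = x∈p∪q⁺ (inj₂ (x∈⁅x⁆ z))

∣p∣≡0⇒p≡∅ : ∀ {N} {p : Subset N} → ∣ p ∣ ≡ 0 → p ≡ ∅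
∣p∣≡0⇒p≡∅ {p = []} _ = refl
∣p∣≡0⇒p≡∅ {p = outside ∷ p} e = cong (outside ∷_) (∣p∣≡0⇒p≡∅ e)

∣p∣≡1⇒p≡⁅x⁆ : ∀ {N} {p : Subset N} → ∣ p ∣ ≡ 1 → ∃ λ x → p ≡ ⁅ x ⁆
∣p∣≡1⇒p≡⁅x⁆ {p = inside ∷ p} e = zero , cong (inside ∷_) (∣p∣≡0⇒p≡∅ (ℕ.suc-injective e))
∣p∣≡1⇒p≡⁅x⁆ {p = outside ∷ p} e with ∣p∣≡1⇒p≡⁅x⁆ {p = p} e
... | x , refl = suc x , refl

∣p∣≡2⇒distinct : ∀ {N} {p : Subset N} → ∣ p ∣ ≡ 2 → ∃₂ λ a b → a ∈ p × b ∈ p × a ≢ b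
∣p∣≡2⇒distinct {p = inside ∷ p} e with ∣p∣≡1⇒p≡⁅x⁆ {p = p} (ℕ.suc-injective e)
... | x , refl = zero , suc x , here , there (x∈⁅x⁆ x) , λ ()
∣p∣≡2⇒distinct {p = outside ∷ p} e with ∣p∣≡2⇒distinct {p = p} e
... | a , b , a∈p , b∈p , a≢b = suc a , suc b , there a∈p , there b∈p , a≢b ∘ Fin.suc-injective

∣p∣≡2⇒other : ∀ {N} {p : Subset N} → ∣ p ∣ ≡ 2 → ∀ x → ∃ λ a → a ∈ p × a ≢ x
∣p∣≡2⇒other ∣p∣≡2 x with ∣p∣≡2⇒distinct ∣p∣≡2
... | a , b , a∈p , b∈p , a≢b with a ≟ x
...   | yes refl = b , b∈p , a≢b ∘ sym
...   | no a≢x = a , a∈p , a≢x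

∣p∣≡2⇒≡⊎≡ : ∀ {N} {p : Subset N} {a b z : Fin N} → ∣ p ∣ ≡ 2 → a ∈ p → b ∈ p → a ≢ b → z ∈ p →
            z ≡ a ⊎ z ≡ b
∣p∣≡2⇒≡⊎≡ {p = p} {a} {b} {z} ∣p∣≡2 a∈p b∈p a≢b z∈p with z ≟ a | z ≟ b
... | yes z≡a | _ = inj₁ z≡a
... | no _ | yes z≡b = inj₂ z≡b
... | no z≢a | no z≢b = ⊥-elim (ℕ.<-irrefl refl (subst (2 <_) ∣p∣≡2 2<∣p∣))
  where
  0<∣p-a-b∣ : 0 < ∣ p - a - b ∣
  0<∣p-a-b∣ = ℕ.≤-trans (s≤s z≤n) (x∈p⇒∣p-x∣<∣p∣ (x∈p∧x≢y⇒x∈p-y (x∈p∧x≢y⇒x∈p-y z∈p z≢a) z≢b))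
  2<∣p∣ : 2 < ∣ p ∣
  2<∣p∣ = ℕ.≤-trans (s≤s (ℕ.≤-trans (s≤s 0<∣p-a-b∣) (x∈p⇒∣p-x∣<∣p∣ (x∈p∧x≢y⇒x∈p-y b∈p (a≢b ∘ sym)))))
                    (x∈p⇒∣p-x∣<∣p∣ a∈p)

-- An element of q would lie in p = {x, y}.
agree⇒¬both∈p─q : ∀ {N} {p q : Subset N} {x y} → ∣ p ∣ ≡ 2 → ∣ q ∣ ≡ 2 → x ≢ y →
                  x ∈ p → y ∈ p → x ∉ q → y ∉ q → ¬ (∀ {z} → z ∈ q → z ≢ x → z ≢ y → z ∈ p)
agree⇒¬both∈p─q {x = x} {y} ∣p∣≡2 ∣q∣≡2 x≢y x∈p y∈p x∉q y∉q q⊆p with ∣p∣≡2⇒distinct ∣q∣≡2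
... | z , _ , z∈q , _ = [ z≢x , z≢y ]′ (∣p∣≡2⇒≡⊎≡ ∣p∣≡2 x∈p y∈p x≢y (q⊆p z∈q z≢x z≢y))
  where
  z≢x : z ≢ x
  z≢x refl = x∉q z∈q
  z≢y : z ≢ y
  z≢y refl = y∉q z∈q

-- A = {p, x} and B = {p, y}: a token moves from x to y while the other stays at p.
Move : ∀ {N} → Subset N → Subset N → Fin N → Fin N → Set
Move A B x y = ∃ λ p → p ∈ A × p ∈ B × x ∈ A × y ∈ B × p ≢ x × p ≢ y

module _ {N : ℕ} {A B : Subset N} {x y : Fin N}
         (∣A∣≡2 : ∣ A ∣ ≡ 2) (∣B∣≡2 : ∣ B ∣ ≡ 2) (x≢y : x ≢ y) where

  move⇒symDiff : Move A B x y → (A ─ B) ∪ (B ─ A) ≡ ⁅ x ⁆ ∪ ⁅ y ⁆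
  move⇒symDiff (p , p∈A , p∈B , x∈A , y∈B , p≢x , p≢y) = ⊆-antisym ⊆pair pair⊆
    where
    x∉B : x ∉ B
    x∉B x∈B = [ p≢x ∘ sym , x≢y ]′ (∣p∣≡2⇒≡⊎≡ ∣B∣≡2 p∈B y∈B p≢y x∈B)
    y∉A : y ∉ A
    y∉A y∈A = [ p≢y ∘ sym , x≢y ∘ sym ]′ (∣p∣≡2⇒≡⊎≡ ∣A∣≡2 p∈A x∈A p≢x y∈A)
    ⊆pair : ∀ {z} → z ∈ (A ─ B) ∪ (B ─ A) → z ∈ ⁅ x ⁆ ∪ ⁅ y ⁆
    ⊆pair z∈ with x∈p─q∪q─p⁻ A B z∈
    ... | inj₁ (z∈A , z∉B) with ∣p∣≡2⇒≡⊎≡ ∣A∣≡2 p∈A x∈A p≢x z∈A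
    ...   | inj₁ refl = ⊥-elim (z∉B p∈B)
    ...   | inj₂ refl = y∈⁅y⁆∪⁅z⁆ x y
    ⊆pair z∈ | inj₂ (z∈B , z∉A) with ∣p∣≡2⇒≡⊎≡ ∣B∣≡2 p∈B y∈B p≢y z∈B
    ...   | inj₁ refl = ⊥-elim (z∉A p∈A)
    ...   | inj₂ refl = z∈⁅y⁆∪⁅z⁆ x y
    pair⊆ : ∀ {z} → z ∈ ⁅ x ⁆ ∪ ⁅ y ⁆ → z ∈ (A ─ B) ∪ (B ─ A)
    pair⊆ z∈ with x∈⁅y⁆∪⁅z⁆⁻ z∈
    ... | inj₁ refl = x∈p∪q⁺ (inj₁ (x∈p∧x∉q⇒x∈p─q x∈A x∉B))
    ... | inj₂ refl = x∈p∪q⁺ (inj₂ (x∈p∧x∉q⇒x∈p─q y∈B y∉A))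

  symDiff⇒move : (A ─ B) ∪ (B ─ A) ≡ ⁅ x ⁆ ∪ ⁅ y ⁆ → Move A B x y ⊎ Move A B y x
  symDiff⇒move AΔB≡ = cases (inΔ (y∈⁅y⁆∪⁅z⁆ x y)) (inΔ (z∈⁅y⁆∪⁅z⁆ x y))
    where
    inΔ : ∀ {z} → z ∈ ⁅ x ⁆ ∪ ⁅ y ⁆ → (z ∈ A × z ∉ B) ⊎ (z ∈ B × z ∉ A)
    inΔ z∈ = x∈p─q∪q─p⁻ A B (subst (_ ∈_) (sym AΔB≡) z∈)
    ∉Δ : ∀ {z} → z ≢ x → z ≢ y → z ∉ (A ─ B) ∪ (B ─ A)
    ∉Δ z≢x z≢y z∈ = [ z≢x , z≢y ]′ (x∈⁅y⁆∪⁅z⁆⁻ (subst (_ ∈_) AΔB≡ z∈))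
    ∈A⇒∈B : ∀ {z} → z ∈ A → z ≢ x → z ≢ y → z ∈ B
    ∈A⇒∈B {z} z∈A z≢x z≢y with z ∈? B
    ... | yes z∈B = z∈B
    ... | no z∉B = ⊥-elim (∉Δ z≢x z≢y (x∈p∪q⁺ (inj₁ (x∈p∧x∉q⇒x∈p─q z∈A z∉B))))
    ∈B⇒∈A : ∀ {z} → z ∈ B → z ≢ x → z ≢ y → z ∈ A
    ∈B⇒∈A {z} z∈B z≢x z≢y with z ∈? A
    ... | yes z∈A = z∈A
    ... | no z∉A = ⊥-elim (∉Δ z≢x z≢y (x∈p∪q⁺ (inj₂ (x∈p∧x∉q⇒x∈p─q z∈B z∉A))))
    cases : (x ∈ A × x ∉ B) ⊎ (x ∈ B × x ∉ A) → (y ∈ A × y ∉ B) ⊎ (y ∈ B × y ∉ A) →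
            Move A B x y ⊎ Move A B y x
    cases (inj₁ (x∈A , x∉B)) (inj₂ (y∈B , y∉A)) with ∣p∣≡2⇒other ∣A∣≡2 x
    ... | p , p∈A , p≢x = inj₁ (p , p∈A , ∈A⇒∈B p∈A p≢x p≢y , x∈A , y∈B , p≢x , p≢y)
      where
      p≢y : p ≢ y
      p≢y refl = y∉A p∈A
    cases (inj₂ (x∈B , x∉A)) (inj₁ (y∈A , y∉B)) with ∣p∣≡2⇒other ∣A∣≡2 y
    ... | p , p∈A , p≢y = inj₂ (p , p∈A , ∈A⇒∈B p∈A p≢x p≢y , y∈A , x∈B , p≢y , p≢x)
      where
      p≢x : p ≢ x
      p≢x refl = x∉A p∈A
    cases (inj₁ (x∈A , x∉B)) (inj₁ (y∈A , y∉B)) =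
      ⊥-elim (agree⇒¬both∈p─q ∣A∣≡2 ∣B∣≡2 x≢y x∈A y∈A x∉B y∉B ∈B⇒∈A)
    cases (inj₂ (x∈B , x∉A)) (inj₂ (y∈B , y∉A)) =
      ⊥-elim (agree⇒¬both∈p─q ∣B∣≡2 ∣A∣≡2 x≢y x∈B y∈B x∉A y∉A ∈A⇒∈B)

symDiff-self : ∀ {N} (A : Subset N) {z} → z ∉ (A ─ A) ∪ (A ─ A)
symDiff-self A z∈ with x∈p─q∪q─p⁻ A A z∈
... | inj₁ (z∈A , z∉A) = z∉A z∈A
... | inj₂ (z∈A , z∉A) = z∉A z∈A

independent⇒¬adjacent : ∀ {N} (G : Graph N) {S A B} → IsIndependentF₂ G S → A ∈ₗ S → B ∈ₗ S →
                        TokenAdj G A B → TokenAdj G B A → ⊥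
independent⇒¬adjacent G (_ , _ , nonadjacent) A∈S B∈S A~B B~A with AllPairs-lookup nonadjacent A∈S B∈S
... | inj₁ refl = let (x , y , _ , _ , AΔA≡) = A~B in
                  symDiff-self _ (subst (x ∈_) (sym AΔA≡) (y∈⁅y⁆∪⁅z⁆ x y))
... | inj₂ (inj₁ A≁B) = A≁B A~B
... | inj₂ (inj₂ B≁A) = B≁A B~A

-- Enumerating 2-subsets

count : ∀ {N} → (Fin N → Bool) → ℕ
count {zero} p = 0
count {suc N} p with p zero
... | true  = suc (count (p ∘ suc))
... | false = count (p ∘ suc)

count-false : ∀ N → count {N} (const false) ≡ 0
count-false zero = refl
count-false (suc N) = count-false N

count-true : ∀ N → count {N} (const true) ≡ N
count-true zero = refl
count-true (suc N) = cong suc (count-true N)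

singletons : ∀ {N} → (Fin N → Bool) → List (Subset N)
singletons {zero} p = []
singletons {suc N} p with p zero
... | true  = ⁅ zero ⁆ ∷ map (outside ∷_) (singletons (p ∘ suc))
... | false = map (outside ∷_) (singletons (p ∘ suc))

length-singletons : ∀ {N} (p : Fin N → Bool) → length (singletons p) ≡ count p
length-singletons {zero} p = refl
length-singletons {suc N} p with p zero
... | true  = cong suc (trans (length-map _ (singletons (p ∘ suc))) (length-singletons (p ∘ suc)))
... | false = trans (length-map _ (singletons (p ∘ suc))) (length-singletons (p ∘ suc))

singletons-sound : ∀ {N} (p : Fin N → Bool) →
                   All (λ v → ∃ λ j → p j ≡ true × v ≡ ⁅ j ⁆) (singletons p)
singletons-sound {zero} p = []
singletons-sound {suc N} p with p zero in p0
... | true  = (zero , p0 , refl) ∷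
              All.map⁺ (All.map (λ (j , pj , eq) → suc j , pj , cong (outside ∷_) eq)
                                (singletons-sound (p ∘ suc)))
... | false = All.map⁺ (All.map (λ (j , pj , eq) → suc j , pj , cong (outside ∷_) eq)
                                (singletons-sound (p ∘ suc)))

⁅j⁆∈singletons : ∀ {N} (p : Fin N → Bool) {j} → p j ≡ true → ⁅ j ⁆ ∈ₗ singletons p
⁅j⁆∈singletons {suc N} p {zero} pj with p zero
... | true = here refl
⁅j⁆∈singletons {suc N} p {suc j} pj with p zero
... | true  = there (∈-map⁺ (outside ∷_) (⁅j⁆∈singletons (p ∘ suc) pj))
... | false = ∈-map⁺ (outside ∷_) (⁅j⁆∈singletons (p ∘ suc) pj)

inside-outside-disjoint : ∀ {N} {xs ys : List (Subset N)} →
                          Disjoint (map (inside ∷_) xs) (map (outside ∷_) ys)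
inside-outside-disjoint (v∈xs , v∈ys) with ∈-map⁻ (inside ∷_) v∈xs | ∈-map⁻ (outside ∷_) v∈ys
... | _ , _ , refl | _ , _ , ()

singletons-unique : ∀ {N} (p : Fin N → Bool) → Unique (singletons p)
singletons-unique {zero} p = []
singletons-unique {suc N} p with p zero
... | true  = All.map⁺ (All.universal (λ _ ()) _) ∷
              Unique.map⁺ Vec.∷-injectiveʳ (singletons-unique (p ∘ suc))
... | false = Unique.map⁺ Vec.∷-injectiveʳ (singletons-unique (p ∘ suc))

Related : ∀ {N} → (Fin N → Fin N → Bool) → Subset N → Set
Related R T = ∀ {x y} → x ∈ T → y ∈ T → x ≢ y → R x y ≡ true

pairs : ∀ {N} → (Fin N → Fin N → Bool) → List (Subset N)
pairs {zero} R = []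
pairs {suc N} R = map (inside ∷_) (singletons (R zero ∘ suc)) ++ map (outside ∷_) (pairs (R on suc))

length-pairs : ∀ {N} (R : Fin (suc N) → Fin (suc N) → Bool) →
               length (pairs R) ≡ count (R zero ∘ suc) + length (pairs (R on suc))
length-pairs R = begin
    length (map (inside ∷_) ones ++ map (outside ∷_) rest)
  ≡⟨ length-++ (map (inside ∷_) ones) ⟩
    length (map (inside ∷_) ones) + length (map (outside ∷_) rest)
  ≡⟨ cong₂ _+_ (length-map _ ones) (length-map _ rest) ⟩
    length ones + length rest
  ≡⟨ cong (_+ length rest) (length-singletons (R zero ∘ suc)) ⟩
    count (R zero ∘ suc) + length rest
  ∎
  where
  open ≡-Reasoning
  ones = singletons (R zero ∘ suc)
  rest = pairs (R on suc)

pairs-sound : ∀ {N} (R : Fin N → Fin N → Bool) → (∀ x y → R x y ≡ R y x) →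
              All (λ T → ∣ T ∣ ≡ 2 × Related R T) (pairs R)
pairs-sound {zero} R R-sym = []
pairs-sound {suc N} R R-sym =
  All.++⁺ (All.map⁺ (All.map withZero (singletons-sound (R zero ∘ suc))))
          (All.map⁺ (All.map withoutZero (pairs-sound (R on suc) (λ x y → R-sym (suc x) (suc y)))))
  where
  withZero : ∀ {v} → (∃ λ j → R zero (suc j) ≡ true × v ≡ ⁅ j ⁆) →
             ∣ inside ∷ v ∣ ≡ 2 × Related R (inside ∷ v)
  withZero (j , R0j , refl) = cong suc (∣⁅x⁆∣≡1 j) , related
    where
    related : Related R (inside ∷ ⁅ j ⁆)
    related here here 0≢0 = ⊥-elim (0≢0 refl)
    related here (there y∈) _ rewrite x∈⁅y⁆⇒x≡y j y∈ = R0j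
    related (there x∈) here _ rewrite x∈⁅y⁆⇒x≡y j x∈ = trans (R-sym _ zero) R0j
    related (there x∈) (there y∈) x≢y =
      ⊥-elim (x≢y (cong suc (trans (x∈⁅y⁆⇒x≡y j x∈) (sym (x∈⁅y⁆⇒x≡y j y∈)))))
  withoutZero : ∀ {v} → ∣ v ∣ ≡ 2 × Related (R on suc) v → ∣ outside ∷ v ∣ ≡ 2 × Related R (outside ∷ v)
  withoutZero (∣v∣≡2 , related) =
    ∣v∣≡2 , λ { (there x∈) (there y∈) x≢y → related x∈ y∈ (x≢y ∘ cong suc) }

pairs-complete : ∀ {N} (R : Fin N → Fin N → Bool) {T} → ∣ T ∣ ≡ 2 → Related R T → T ∈ₗ pairs R
pairs-complete {suc N} R {inside ∷ v} ∣T∣≡2 related with ∣p∣≡1⇒p≡⁅x⁆ {p = v} (ℕ.suc-injective ∣T∣≡2)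
... | j , refl =
  ∈-++⁺ˡ (∈-map⁺ (inside ∷_) (⁅j⁆∈singletons (R zero ∘ suc) (related here (there (x∈⁅x⁆ j)) λ ())))
pairs-complete {suc N} R {outside ∷ v} ∣T∣≡2 related =
  ∈-++⁺ʳ (map (inside ∷_) (singletons (R zero ∘ suc)))
         (∈-map⁺ (outside ∷_) (pairs-complete (R on suc) ∣T∣≡2 related′))
  where
  related′ : Related (R on suc) v
  related′ x∈ y∈ x≢y = related (there x∈) (there y∈) (x≢y ∘ Fin.suc-injective)

pairs-unique : ∀ {N} (R : Fin N → Fin N → Bool) → Unique (pairs R)
pairs-unique {zero} R = []
pairs-unique {suc N} R =
  Unique.++⁺ (Unique.map⁺ Vec.∷-injectiveʳ (singletons-unique (R zero ∘ suc)))
             (Unique.map⁺ Vec.∷-injectiveʳ (pairs-unique (R on suc)))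
             inside-outside-disjoint

left : (m : ℕ) {n : ℕ} → Fin (m + n) → Bool
left zero    v       = false
left (suc m) zero    = true
left (suc m) (suc v) = left m v

left⇒< : ∀ m {n} (v : Fin (m + n)) → left m v ≡ true → toℕ v < m
left⇒< (suc m) zero    _ = s≤s z≤n
left⇒< (suc m) (suc v) e = s≤s (left⇒< m v e)

¬left⇒≥ : ∀ m {n} (v : Fin (m + n)) → left m v ≡ false → m ≤ toℕ v
¬left⇒≥ zero    v       _ = z≤n
¬left⇒≥ (suc m) (suc v) e = s≤s (¬left⇒≥ m v e)

K-adjacent⇒left≢ : ∀ m n {x y} → Adj (K m n) x y → left m x ≢ left m y
K-adjacent⇒left≢ m n {x} {y} x~y x≡y with left m x in ex | left m y in ey | x~y
... | true  | true  | inj₁ (_ , m≤y) = ℕ.<⇒≱ (left⇒< m y ey) m≤y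
... | true  | true  | inj₂ (m≤x , _) = ℕ.<⇒≱ (left⇒< m x ex) m≤x
... | false | false | inj₁ (x<m , _) = ℕ.<⇒≱ x<m (¬left⇒≥ m x ex)
... | false | false | inj₂ (_ , y<m) = ℕ.<⇒≱ y<m (¬left⇒≥ m y ey)

left≢⇒K-adjacent : ∀ m n {x y} → left m x ≢ left m y → Adj (K m n) x y
left≢⇒K-adjacent m n {x} {y} x≢y with left m x in ex | left m y in ey
... | true  | true  = ⊥-elim (x≢y refl)
... | true  | false = inj₁ (left⇒< m x ex , ¬left⇒≥ m y ey)
... | false | true  = inj₂ (¬left⇒≥ m x ex , left⇒< m y ey)
... | false | false = ⊥-elim (x≢y refl)

count-left : ∀ m n → count (left m {n}) ≡ m
count-left zero    n = count-false n
count-left (suc m) n = cong suc (count-left m n)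

count-right : ∀ m n → count (not ∘ left m {n}) ≡ n
count-right zero    n = count-true n
count-right (suc m) n = count-right m n

-- The part of a vertex (true = left) and whether it is marked.
Label : Set
Label = Bool × Bool

-- Compatible labels carry the same mark, and lie in different parts exactly when marked.
compatible : Label → Label → Bool
compatible (s , true)  (t , μ) = μ ∧ (s xor t)
compatible (s , false) (t , μ) = not μ ∧ not (s xor t)

compatible-comm : ∀ k l → compatible k l ≡ compatible l k
compatible-comm (s , true)  (t , true)  = Bool.xor-comm s t
compatible-comm (s , true)  (t , false) = refl
compatible-comm (s , false) (t , true)  = refl
compatible-comm (s , false) (t , false) = cong not (Bool.xor-comm s t)

compatible⇒xor : ∀ {s t μ ν} → compatible (s , μ) (t , ν) ≡ true → s xor t ≡ μ
compatible⇒xor {μ = true}  {true}  e = e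
compatible⇒xor {true}  {true}  {false} {false} _ = refl
compatible⇒xor {false} {false} {false} {false} _ = refl
compatible⇒xor {true}  {false} {false} {false} ()
compatible⇒xor {false} {true}  {false} {false} ()
compatible⇒xor {μ = true}  {false} ()
compatible⇒xor {μ = false} {true}  ()

xor-cancelʳ : ∀ {s t} u → s xor u ≡ t xor u → s ≡ t
xor-cancelʳ {true}  {true}  _ _ = refl
xor-cancelʳ {false} {false} _ _ = refl
xor-cancelʳ {true}  {false} false ()
xor-cancelʳ {true}  {false} true  ()
xor-cancelʳ {false} {true}  false ()
xor-cancelʳ {false} {true}  true  ()

compatible-unmarked : ∀ {s t} → s ≡ t → compatible (s , false) (t , false) ≡ true
compatible-unmarked {s} refl = cong not (Bool.xor-same s)

compatible-marked : ∀ {s t} → s ≢ t → compatible (s , true) (t , true) ≡ true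
compatible-marked {true}  {true}  s≢t = ⊥-elim (s≢t refl)
compatible-marked {true}  {false} _   = refl
compatible-marked {false} {true}  _   = refl
compatible-marked {false} {false} s≢t = ⊥-elim (s≢t refl)

module _ {N : ℕ} (ℓ : Fin N → Label) where

  leftUnmarked rightUnmarked leftMarked rightMarked : ℕ
  leftUnmarked  = count (compatible (true , false) ∘ ℓ)
  rightUnmarked = count (compatible (false , false) ∘ ℓ)
  -- the marked vertices of one part are those compatible with a marked vertex of the other
  leftMarked    = count (compatible (false , true) ∘ ℓ)
  rightMarked   = count (compatible (true , true) ∘ ℓ)

leftUnmarked+leftMarked : ∀ {N} (ℓ : Fin N → Label) → leftUnmarked ℓ + leftMarked ℓ ≡ count (proj₁ ∘ ℓ)
leftUnmarked+leftMarked {zero} ℓ = refl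
leftUnmarked+leftMarked {suc N} ℓ with ℓ zero | leftUnmarked+leftMarked (ℓ ∘ suc)
... | true  , false | ih = cong suc ih
... | true  , true  | ih = trans (ℕ.+-suc _ _) (cong suc ih)
... | false , false | ih = ih
... | false , true  | ih = ih

rightUnmarked+rightMarked : ∀ {N} (ℓ : Fin N → Label) →
                            rightUnmarked ℓ + rightMarked ℓ ≡ count (not ∘ proj₁ ∘ ℓ)
rightUnmarked+rightMarked {zero} ℓ = refl
rightUnmarked+rightMarked {suc N} ℓ with ℓ zero | rightUnmarked+rightMarked (ℓ ∘ suc)
... | false , false | ih = cong suc ih
... | false , true  | ih = trans (ℕ.+-suc _ _) (cong suc ih)
... | true  , false | ih = ih
... | true  , true  | ih = ih

-- Counting compatible pairs

choose₂ : ℕ → ℕ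
choose₂ zero    = 0
choose₂ (suc n) = choose₂ n + n

C2≡choose₂ : ∀ n → n C 2 ≡ choose₂ n
C2≡choose₂ zero    = refl
C2≡choose₂ (suc n) = begin
    suc n C 2            ≡⟨ nCk+nC[k+1]≡[n+1]C[k+1] n 1 ⟨
    n C 1 + n C 2        ≡⟨ cong₂ _+_ (nC1≡n n) (C2≡choose₂ n) ⟩
    n + choose₂ n        ≡⟨ ℕ.+-comm n (choose₂ n) ⟩
    choose₂ n + n        ∎
  where open ≡-Reasoning

compatiblePairs : ℕ → ℕ → ℕ → ℕ → ℕ
compatiblePairs a b c d = choose₂ a + choose₂ b + c * d

compatiblePairs-sucᵃ : ∀ a b c d → a + compatiblePairs a b c d ≡ compatiblePairs (suc a) b c d
compatiblePairs-sucᵃ a b c d = identity (choose₂ a) (choose₂ b) a (c * d)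
  where
  identity : ∀ Ca Cb a cd → a + (Ca + Cb + cd) ≡ Ca + a + Cb + cd
  identity = solve-∀

compatiblePairs-sucᵇ : ∀ a b c d → b + compatiblePairs a b c d ≡ compatiblePairs a (suc b) c d
compatiblePairs-sucᵇ a b c d = identity (choose₂ a) (choose₂ b) b (c * d)
  where
  identity : ∀ Ca Cb b cd → b + (Ca + Cb + cd) ≡ Ca + (Cb + b) + cd
  identity = solve-∀

compatiblePairs-sucᶜ : ∀ a b c d → d + compatiblePairs a b c d ≡ compatiblePairs a b (suc c) d
compatiblePairs-sucᶜ a b c d = identity (choose₂ a) (choose₂ b) c d
  where
  identity : ∀ Ca Cb c d → d + (Ca + Cb + c * d) ≡ Ca + Cb + suc c * d
  identity = solve-∀

compatiblePairs-sucᵈ : ∀ a b c d → c + compatiblePairs a b c d ≡ compatiblePairs a b c (suc d)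
compatiblePairs-sucᵈ a b c d = identity (choose₂ a) (choose₂ b) c d
  where
  identity : ∀ Ca Cb c d → c + (Ca + Cb + c * d) ≡ Ca + Cb + c * suc d
  identity = solve-∀

length-compatiblePairs : ∀ {N} (ℓ : Fin N → Label) →
  length (pairs (compatible on ℓ)) ≡
    compatiblePairs (leftUnmarked ℓ) (rightUnmarked ℓ) (leftMarked ℓ) (rightMarked ℓ)
length-compatiblePairs {zero} ℓ = refl
length-compatiblePairs {suc N} ℓ
  rewrite length-pairs (compatible on ℓ) | length-compatiblePairs (ℓ ∘ suc)
  with ℓ zero
... | true  , false = compatiblePairs-sucᵃ (leftUnmarked (ℓ ∘ suc)) (rightUnmarked (ℓ ∘ suc))
                                           (leftMarked (ℓ ∘ suc)) (rightMarked (ℓ ∘ suc))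
... | false , false = compatiblePairs-sucᵇ (leftUnmarked (ℓ ∘ suc)) (rightUnmarked (ℓ ∘ suc))
                                           (leftMarked (ℓ ∘ suc)) (rightMarked (ℓ ∘ suc))
... | true  , true  = compatiblePairs-sucᶜ (leftUnmarked (ℓ ∘ suc)) (rightUnmarked (ℓ ∘ suc))
                                           (leftMarked (ℓ ∘ suc)) (rightMarked (ℓ ∘ suc))
... | false , true  = compatiblePairs-sucᵈ (leftUnmarked (ℓ ∘ suc)) (rightUnmarked (ℓ ∘ suc))
                                           (leftMarked (ℓ ∘ suc)) (rightMarked (ℓ ∘ suc))

choose₂-+ : ∀ x y → choose₂ (x + y) ≡ choose₂ x + choose₂ y + x * y
choose₂-+ zero    y = sym (ℕ.+-identityʳ (choose₂ y))
choose₂-+ (suc x) y = trans (cong (_+ (x + y)) (choose₂-+ x y)) (identity (choose₂ x) (choose₂ y) x y)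
  where
  identity : ∀ Cx Cy x y → Cx + Cy + x * y + (x + y) ≡ Cx + x + Cy + suc x * y
  identity = solve-∀

C[m+n]2∸mn : ∀ m n → (m + n) C 2 ∸ m * n ≡ choose₂ m + choose₂ n
C[m+n]2∸mn m n = begin
    (m + n) C 2 ∸ m * n                        ≡⟨ cong (_∸ m * n) (C2≡choose₂ (m + n)) ⟩
    choose₂ (m + n) ∸ m * n                    ≡⟨ cong (_∸ m * n) (choose₂-+ m n) ⟩
    choose₂ m + choose₂ n + m * n ∸ m * n      ≡⟨ ℕ.m+n∸n≡m (choose₂ m + choose₂ n) (m * n) ⟩
    choose₂ m + choose₂ n                      ∎
  where open ≡-Reasoning

*≤choose₂ : ∀ c d → c * d ≤ choose₂ (suc c) + choose₂ d
*≤choose₂ zero    d       = z≤n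
*≤choose₂ (suc c) zero    = subst (_≤ choose₂ (suc (suc c)) + 0) (sym (ℕ.*-zeroʳ (suc c))) z≤n
*≤choose₂ (suc c) (suc d) = begin
    suc c * suc d                                ≡⟨ expand₁ c d ⟩
    c * d + (suc c + d)                          ≤⟨ ℕ.+-monoˡ-≤ (suc c + d) (*≤choose₂ c d) ⟩
    choose₂ c + c + choose₂ d + (suc c + d)      ≡⟨ expand₂ (choose₂ c) (choose₂ d) c d ⟩
    choose₂ (suc (suc c)) + choose₂ (suc d)      ∎
  where
  open ℕ.≤-Reasoning
  expand₁ : ∀ c d → suc c * suc d ≡ c * d + (suc c + d)
  expand₁ = solve-∀
  expand₂ : ∀ Cc Cd c d → Cc + c + Cd + (suc c + d) ≡ Cc + c + suc c + (Cd + d)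
  expand₂ = solve-∀

compatiblePairs≤choose₂ : ∀ a b c d → NonZero a →
                          compatiblePairs a b c d ≤ choose₂ (a + c) + choose₂ (b + d)
compatiblePairs≤choose₂ a b c d a≢0 = begin
    choose₂ a + choose₂ b + c * d
  ≤⟨ ℕ.+-monoʳ-≤ (choose₂ a + choose₂ b) (*≤choose₂ c d) ⟩
    choose₂ a + choose₂ b + (choose₂ c + c + choose₂ d)
  ≤⟨ ℕ.+-monoʳ-≤ (choose₂ a + choose₂ b)
                 (ℕ.+-monoˡ-≤ (choose₂ d) (ℕ.+-monoʳ-≤ (choose₂ c) (ℕ.m≤n*m c a {{a≢0}}))) ⟩
    choose₂ a + choose₂ b + (choose₂ c + a * c + choose₂ d)
  ≤⟨ ℕ.m≤m+n _ (b * d) ⟩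
    choose₂ a + choose₂ b + (choose₂ c + a * c + choose₂ d) + b * d
  ≡⟨ regroup (choose₂ a) (choose₂ b) (choose₂ c) (choose₂ d) (a * c) (b * d) ⟩
    (choose₂ a + choose₂ c + a * c) + (choose₂ b + choose₂ d + b * d)
  ≡⟨ cong₂ _+_ (choose₂-+ a c) (choose₂-+ b d) ⟨
    choose₂ (a + c) + choose₂ (b + d)
  ∎
  where
  open ℕ.≤-Reasoning
  regroup : ∀ Ca Cb Cc Cd ac bd → Ca + Cb + (Cc + ac + Cd) + bd ≡ (Ca + Cc + ac) + (Cb + Cd + bd)
  regroup = solve-∀

compatiblePairs-comm : ∀ a b c d → compatiblePairs a b c d ≡ compatiblePairs b a d c
compatiblePairs-comm a b c d = cong₂ _+_ (ℕ.+-comm (choose₂ a) (choose₂ b)) (ℕ.*-comm c d)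

compatiblePairs-bound : ∀ a b c d {m n} → a + c ≡ m → b + d ≡ n →
                        compatiblePairs a b c d ≤ m * n ⊔ ((m + n) C 2 ∸ m * n)
compatiblePairs-bound zero    zero    c d refl refl = ℕ.m≤m⊔n (c * d) _
compatiblePairs-bound (suc a) b       c d refl refl = begin
    compatiblePairs (suc a) b c d                 ≤⟨ compatiblePairs≤choose₂ (suc a) b c d _ ⟩
    choose₂ (suc a + c) + choose₂ (b + d)         ≡⟨ C[m+n]2∸mn (suc a + c) (b + d) ⟨
    (suc a + c + (b + d)) C 2 ∸ (suc a + c) * (b + d)  ≤⟨ ℕ.m≤n⊔m _ _ ⟩
    _                                             ∎
  where open ℕ.≤-Reasoning
compatiblePairs-bound zero    (suc b) c d refl refl = begin
    compatiblePairs zero (suc b) c d              ≡⟨ compatiblePairs-comm zero (suc b) c d ⟩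
    compatiblePairs (suc b) zero d c              ≤⟨ compatiblePairs≤choose₂ (suc b) zero d c _ ⟩
    choose₂ (suc b + d) + choose₂ c               ≡⟨ ℕ.+-comm (choose₂ (suc b + d)) (choose₂ c) ⟩
    choose₂ c + choose₂ (suc b + d)               ≡⟨ C[m+n]2∸mn c (suc b + d) ⟨
    (c + (suc b + d)) C 2 ∸ c * (suc b + d)       ≤⟨ ℕ.m≤n⊔m _ _ ⟩
    _                                             ∎
  where open ℕ.≤-Reasoning

labelling : ∀ m {n} → (Fin (m + n) → Bool) → Fin (m + n) → Label
labelling m marked v = left m v , marked v

module _ (m n : ℕ) (marked : Fin (m + n) → Bool) where

  private
    ℓ = labelling m marked

  labelling-left : leftUnmarked ℓ + leftMarked ℓ ≡ m
  labelling-left = trans (leftUnmarked+leftMarked ℓ) (count-left m n)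

  labelling-right : rightUnmarked ℓ + rightMarked ℓ ≡ n
  labelling-right = trans (rightUnmarked+rightMarked ℓ) (count-right m n)

  length-compatiblePairs≤ : length (pairs (compatible on ℓ)) ≤ m * n ⊔ ((m + n) C 2 ∸ m * n)
  length-compatiblePairs≤ = begin
      length (pairs (compatible on ℓ))
    ≡⟨ length-compatiblePairs ℓ ⟩
      compatiblePairs (leftUnmarked ℓ) (rightUnmarked ℓ) (leftMarked ℓ) (rightMarked ℓ)
    ≤⟨ compatiblePairs-bound (leftUnmarked ℓ) (rightUnmarked ℓ) (leftMarked ℓ) (rightMarked ℓ)
                             labelling-left labelling-right ⟩
      m * n ⊔ ((m + n) C 2 ∸ m * n)
    ∎
    where open ℕ.≤-Reasoning

-- Lower bound

module _ (m n : ℕ) where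

  uniformPairs : Bool → List (Subset (m + n))
  uniformPairs μ = pairs (compatible on (labelling m (const μ)))

  uniformPairs-independent : ∀ μ → IsIndependentF₂ (K m n) (uniformPairs μ)
  uniformPairs-independent μ = All.map proj₁ sound , pairs-unique _ , All⇒AllPairs nonadjacent sound
    where
    ℓ = labelling m (const μ)
    R = compatible on ℓ
    sound = pairs-sound R (λ x y → compatible-comm (ℓ x) (ℓ y))
    nonadjacent : ∀ {A B} → ∣ A ∣ ≡ 2 × Related R A → ∣ B ∣ ≡ 2 × Related R B → ¬ TokenAdj (K m n) A B
    nonadjacent {A} {B} (∣A∣≡2 , A-related) (∣B∣≡2 , B-related) (x , y , x≢y , x~y , AΔB≡) =
      K-adjacent⇒left≢ m n x~y ([ sameSide , sym ∘ sameSide ]′ (symDiff⇒move ∣A∣≡2 ∣B∣≡2 x≢y AΔB≡))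
      where
      sameSide : ∀ {u v} → Move A B u v → left m u ≡ left m v
      sameSide {u} {v} (p , p∈A , p∈B , u∈A , v∈B , p≢u , p≢v) = xor-cancelʳ (left m p)
        (trans (compatible⇒xor {left m u} {left m p} {μ} {μ} (A-related u∈A p∈A (p≢u ∘ sym)))
               (sym (compatible⇒xor {left m v} {left m p} {μ} {μ} (B-related v∈B p∈B (p≢v ∘ sym)))))

  length-sameSidePairs : length (uniformPairs false) ≡ choose₂ m + choose₂ n
  length-sameSidePairs = begin
      length (uniformPairs false)
    ≡⟨ length-compatiblePairs ℓ ⟩
      choose₂ (leftUnmarked ℓ) + choose₂ (rightUnmarked ℓ) + leftMarked ℓ * rightMarked ℓ
    ≡⟨ cong (λ c → choose₂ (leftUnmarked ℓ) + choose₂ (rightUnmarked ℓ) + c * rightMarked ℓ)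
            (count-false (m + n)) ⟩
      choose₂ (leftUnmarked ℓ) + choose₂ (rightUnmarked ℓ) + 0
    ≡⟨ ℕ.+-identityʳ _ ⟩
      choose₂ (leftUnmarked ℓ) + choose₂ (rightUnmarked ℓ)
    ≡⟨ cong₂ (λ a b → choose₂ a + choose₂ b)
             (noMarked (labelling-left m n _)) (noMarked (labelling-right m n _)) ⟩
      choose₂ m + choose₂ n
    ∎
    where
    open ≡-Reasoning
    ℓ = labelling m (const false)
    noMarked : ∀ {a k} → a + count {m + n} (const false) ≡ k → a ≡ k
    noMarked {a} a+0≡k =
      trans (sym (ℕ.+-identityʳ a)) (trans (cong (a +_) (sym (count-false (m + n)))) a+0≡k)

  length-crossPairs : length (uniformPairs true) ≡ m * n
  length-crossPairs = begin
      length (uniformPairs true)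
    ≡⟨ length-compatiblePairs ℓ ⟩
      compatiblePairs (leftUnmarked ℓ) (rightUnmarked ℓ) (leftMarked ℓ) (rightMarked ℓ)
    ≡⟨ cong₂ (λ a b → compatiblePairs a b (leftMarked ℓ) (rightMarked ℓ))
             (count-false (m + n)) (count-false (m + n)) ⟩
      leftMarked ℓ * rightMarked ℓ
    ≡⟨ cong₂ _*_ (noUnmarked (labelling-left m n _)) (noUnmarked (labelling-right m n _)) ⟩
      m * n
    ∎
    where
    open ≡-Reasoning
    ℓ = labelling m (const true)
    noUnmarked : ∀ {c k} → count {m + n} (const false) + c ≡ k → c ≡ k
    noUnmarked {c} 0+c≡k = trans (cong (_+ c) (sym (count-false (m + n)))) 0+c≡k

  lowerBound : ∃ λ S → IsIndependentF₂ (K m n) S × length S ≡ m * n ⊔ ((m + n) C 2 ∸ m * n)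
  lowerBound with ℕ.≤-total (m * n) ((m + n) C 2 ∸ m * n)
  ... | inj₁ mn≤ = uniformPairs false , uniformPairs-independent false ,
                   trans length-sameSidePairs (trans (sym (C[m+n]2∸mn m n)) (sym (ℕ.m≤n⇒m⊔n≡n mn≤)))
  ... | inj₂ mn≥ = uniformPairs true , uniformPairs-independent true ,
                   trans length-crossPairs (sym (ℕ.m≥n⇒m⊔n≡m mn≥))

-- Upper bound

module UpperBound (m n : ℕ) (S : List (Subset (m + n))) (S-independent : IsIndependentF₂ (K m n) S) where

  private
    tokens = proj₁ S-independent

  InCrossToken : Fin (m + n) → Set
  InCrossToken v = Any (λ A → v ∈ A × ∃ λ w → w ∈ A × left m w ≢ left m v) S

  inCrossToken? : ∀ v → Dec (InCrossToken v)
  inCrossToken? v =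
    any? (λ A → (v ∈? A) ×-dec Fin.any? (λ w → (w ∈? A) ×-dec ¬? (left m w Bool.≟ left m v))) S

  marked : Fin (m + n) → Bool
  marked v = does (inCrossToken? v)

  cross⇒marked : ∀ {A v w} → A ∈ₗ S → v ∈ A → w ∈ A → left m w ≢ left m v → marked v ≡ true
  cross⇒marked {A} {v} A∈S v∈A w∈A w≢v with inCrossToken? v
  ... | yes _ = refl
  ... | no ¬cross = ⊥-elim (¬cross (lose A∈S (v∈A , _ , w∈A , w≢v)))

  sameSide⇒unmarked : ∀ {A x y} → A ∈ₗ S → x ∈ A → y ∈ A → x ≢ y → left m x ≡ left m y →
                      marked x ≡ false
  sameSide⇒unmarked {A} {x} {y} A∈S x∈A y∈A x≢y x≡y with inCrossToken? x
  ... | no _ = refl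
  ... | yes cross with find cross
  ...   | B , B∈S , x∈B , z , z∈B , z≢x =
    ⊥-elim (independent⇒¬adjacent (K m n) S-independent A∈S B∈S A~B B~A)
    where
    ∣A∣≡2 = All.lookup tokens A∈S
    ∣B∣≡2 = All.lookup tokens B∈S
    x≢z : x ≢ z
    x≢z refl = z≢x refl
    y≢z : y ≢ z
    y≢z refl = z≢x (sym x≡y)
    A~B : TokenAdj (K m n) A B
    A~B = y , z , y≢z , left≢⇒K-adjacent m n (λ y≡z → z≢x (trans (sym y≡z) (sym x≡y))) ,
          move⇒symDiff ∣A∣≡2 ∣B∣≡2 y≢z (x , x∈A , x∈B , y∈A , z∈B , x≢y , x≢z)
    B~A : TokenAdj (K m n) B A
    B~A = z , y , y≢z ∘ sym , left≢⇒K-adjacent m n (λ z≡y → z≢x (trans z≡y (sym x≡y))) ,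
          move⇒symDiff ∣B∣≡2 ∣A∣≡2 (y≢z ∘ sym) (x , x∈B , x∈A , z∈B , y∈A , x≢z , x≢y)

  tokens-compatible : ∀ {A} → A ∈ₗ S → Related (compatible on (labelling m marked)) A
  tokens-compatible A∈S {x} {y} x∈A y∈A x≢y with left m x Bool.≟ left m y
  ... | yes x≡y
    rewrite sameSide⇒unmarked A∈S x∈A y∈A x≢y x≡y | sameSide⇒unmarked A∈S y∈A x∈A (x≢y ∘ sym) (sym x≡y)
    = compatible-unmarked x≡y
  ... | no x≢y′
    rewrite cross⇒marked A∈S x∈A y∈A (x≢y′ ∘ sym) | cross⇒marked A∈S y∈A x∈A x≢y′
    = compatible-marked x≢y′

  upperBound : length S ≤ m * n ⊔ ((m + n) C 2 ∸ m * n)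
  upperBound =
    ℕ.≤-trans (unique-⊆⇒length≤ (proj₁ (proj₂ S-independent)) S⊆pairs) (length-compatiblePairs≤ m n marked)
    where
    S⊆pairs : ∀ {A} → A ∈ₗ S → A ∈ₗ pairs (compatible on (labelling m marked))
    S⊆pairs A∈S = pairs-complete _ (All.lookup tokens A∈S) (tokens-compatible A∈S)

theorem1p2 : (m n : ℕ) → NonZero m → NonZero n →
    IndepNumberF₂ (K m n) ((m * n) ⊔ (((m + n) C 2) ∸ (m * n)))
theorem1p2 m n _ _ = lowerBound m n , UpperBound.upperBound m n
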